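{- Let $k$ be a positive integer and let $\mathcal{H}$ be a hypergraph on a finite set disjoint from $[k]=\{1,\dots,k\}$ which either satisfies property (C) or equals $\{\{a_1\},\dots,\{a_\ell\}\}$ on an $\ell$-element vertex set $\{a_1,\dots,a_\ell\}$ for some positive integer $\ell$. Then the conjunctive compound $\mathcal{H}\otimes\binom{[k]}{1}$ satisfies property (C).
   Context: A hypergraph on a finite set $V$ is a family of nonempty subsets (edges) covering $V$. $\binom{[k]}{1}=\{\{1\},\dots,\{k\}\}$. A sequence of edges $H_0,\dots,H_q$ is a chain if for all $i=0,\dots,q-1$: $H_{i+1}\cap H_i\neq\emptyset$, $|H_{i+1}\setminus H_i|=1$ and $H_i\subseteq H_0\cup H_q$. Property (C): for any two distinct edges $H,H'$ there is a chain with $H_0=H$ and $H_q=H'$. Conjunctive compound of hypergraphs $\mathcal{F}^1,\mathcal{F}^2$ on disjoint vertex sets: $\{F^1\cup F^2\mid F^1\in\mathcal{F}^1,F^2\in\mathcal{F}^2\}$. -}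

module Defs where

open import Data.Nat using (ℕ; zero; suc; _+_; _≤_)
open import Data.Fin using (Fin; inject₁; fromℕ)
import Data.Fin as F
open import Data.Fin.Subset using (Subset; _∈_; _⊆_; _∩_; _∪_; _─_; ∣_∣; Nonempty; ⁅_⁆)
open import Data.Vec using (_++_)
open import Data.Product using (Σ; ∃; ∃₂; _×_; _,_)
open import Relation.Binary.PropositionalEquality using (_≡_; _≢_)

-- A family of subsets of the vertex set Fin n (a set of edges, given by
-- its membership predicate; finite automatically since Subset n is finite).
Family : ℕ → Set₁
Family n = Subset n → Set

record IsHypergraph {n : ℕ} (ℋ : Family n) : Set where
  field
    nonempty : ∀ E → ℋ E → Nonempty E
    covers   : ∀ (v : Fin n) → ∃ λ E → ℋ E × v ∈ E

record IsChain {n : ℕ} (ℋ : Family n) (q : ℕ) (C : Fin (suc q) → Subset n) : Set where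
  field
    edges     : ∀ i → ℋ (C i)
    meets     : ∀ (i : Fin q) → Nonempty (C (F.suc i) ∩ C (inject₁ i))
    oneNew    : ∀ (i : Fin q) → ∣ C (F.suc i) ─ C (inject₁ i) ∣ ≡ 1
    insideEnds : ∀ (i : Fin q) → C (inject₁ i) ⊆ (C F.zero ∪ C (fromℕ q))

PropertyC : {n : ℕ} → Family n → Set
PropertyC {n} ℋ =
  ∀ H H' → ℋ H → ℋ H' → H ≢ H' →
  ∃₂ λ (q : ℕ) (C : Fin (suc q) → Subset n) →
    IsChain ℋ q C × C F.zero ≡ H × C (fromℕ q) ≡ H'

Singletons : (n : ℕ) → Family n
Singletons n E = ∃ λ (a : Fin n) → E ≡ ⁅ a ⁆

-- Conjunctive compound of families on disjoint vertex sets Fin m and Fin k;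
-- the vertex set of the compound is Fin (m + k) (first m vertices from the
-- first, last k from the second), and F¹ ∪ F² is the concatenation.
_⊗_ : {m k : ℕ} → Family m → Family k → Family (m + k)
(ℱ₁ ⊗ ℱ₂) E = ∃₂ λ F₁ F₂ → ℱ₁ F₁ × ℱ₂ F₂ × E ≡ F₁ ++ F₂

-- A chain of ℋ from F to F' survives the compound with {i}: the common
-- vertex i supplies every meeting H_{i+1} ∩ H_i, so ℋ only needs chains
-- without that requirement, which the singleton hypergraph also has.  When
-- the second coordinates differ, one first step from F ∪ {i} to F ∪ {j}
-- adds exactly j and meets in the nonempty edge F.
module Submission where

open import Defs
open import Data.Bool using (_≟_)
open import Data.Empty using (⊥-elim)
open import Data.Nat using (ℕ; suc; _+_; _≤_)
open import Data.Fin using (Fin; inject₁; fromℕ; _↑ˡ_; _↑ʳ_)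
import Data.Fin as F
open import Data.Fin.Subset
  using (Subset; _⊆_; _∩_; _∪_; _─_; ∣_∣; Nonempty; ⁅_⁆; ⊥; inside; outside)
open import Data.Fin.Subset.Properties
  using (x∈⁅x⁆; ∣⁅x⁆∣≡1; p─⊥≡p; p⊆p∪q; q⊆p∪q; x∈p∩q⁺; drop-∷-⊆)
open import Data.Product using (∃₂; _×_; _,_)
open import Data.Sum using (_⊎_; inj₁; inj₂)
open import Data.Vec using ([]; _∷_; _++_; here; there)
open import Data.Vec.Functional using () renaming (_∷_ to _◂_)
open import Data.Vec.Properties
  using (zipWith-++; lookup-++ˡ; lookup-++ʳ; lookup⇒[]=; []=⇒lookup; ≡-dec)
open import Function using (_∘_)
open import Function.Bundles using (_⇔_; Equivalence)
open import Relation.Binary.PropositionalEquality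
  using (_≡_; _≢_; refl; sym; trans; cong; cong₂; subst; module ≡-Reasoning)
open import Relation.Nullary using (yes; no)

private
  variable
    m n k q : ℕ

∩-++ : (p p' : Subset m) (r r' : Subset k) → (p ++ r) ∩ (p' ++ r') ≡ (p ∩ p') ++ (r ∩ r')
∩-++ p p' r r' = zipWith-++ _ p r p' r'

∪-++ : (p p' : Subset m) (r r' : Subset k) → (p ++ r) ∪ (p' ++ r') ≡ (p ∪ p') ++ (r ∪ r')
∪-++ p p' r r' = zipWith-++ _ p r p' r'

─-++ : (p p' : Subset m) (r r' : Subset k) → (p ++ r) ─ (p' ++ r') ≡ (p ─ p') ++ (r ─ r')
─-++ p p' r r' = zipWith-++ _ p r p' r'

∣p++r∣≡∣p∣+∣r∣ : (p : Subset m) (r : Subset k) → ∣ p ++ r ∣ ≡ ∣ p ∣ + ∣ r ∣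
∣p++r∣≡∣p∣+∣r∣ []            r = refl
∣p++r∣≡∣p∣+∣r∣ (inside  ∷ p) r = cong suc (∣p++r∣≡∣p∣+∣r∣ p r)
∣p++r∣≡∣p∣+∣r∣ (outside ∷ p) r = ∣p++r∣≡∣p∣+∣r∣ p r

∣─-++∣ : (p p' : Subset m) (r r' : Subset k) →
         ∣ (p ++ r) ─ (p' ++ r') ∣ ≡ ∣ p ─ p' ∣ + ∣ r ─ r' ∣
∣─-++∣ p p' r r' = trans (cong ∣_∣ (─-++ p p' r r')) (∣p++r∣≡∣p∣+∣r∣ (p ─ p') (r ─ r'))

Nonempty-++ˡ : {p : Subset m} (r : Subset k) → Nonempty p → Nonempty (p ++ r)
Nonempty-++ˡ {p = p} r (x , x∈p) =
  x ↑ˡ _ , lookup⇒[]= _ (p ++ r) (trans (lookup-++ˡ p r x) ([]=⇒lookup x∈p))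

Nonempty-++ʳ : (p : Subset m) {r : Subset k} → Nonempty r → Nonempty (p ++ r)
Nonempty-++ʳ p {r} (x , x∈r) =
  _ ↑ʳ x , lookup⇒[]= _ (p ++ r) (trans (lookup-++ʳ p r x) ([]=⇒lookup x∈r))

Nonempty-∩-self : {p : Subset n} → Nonempty p → Nonempty (p ∩ p)
Nonempty-∩-self (x , x∈p) = x , x∈p∩q⁺ (x∈p , x∈p)

⊆-++ : {p p' : Subset m} {r r' : Subset k} → p ⊆ p' → r ⊆ r' → p ++ r ⊆ p' ++ r'
⊆-++ {p = []}    {[]}     _    r⊆r' x∈r = r⊆r' x∈r
⊆-++ {p = _ ∷ _} {_ ∷ _} p⊆p' _    here with p⊆p' here
... | here = here
⊆-++ {p = _ ∷ _} {_ ∷ _} p⊆p' r⊆r' (there x∈) = there (⊆-++ (drop-∷-⊆ p⊆p') r⊆r' x∈)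

++-⊆-∪ : {p p₁ p₂ : Subset m} {r r₁ r₂ : Subset k} →
         p ⊆ p₁ ∪ p₂ → r ⊆ r₁ ∪ r₂ → p ++ r ⊆ (p₁ ++ r₁) ∪ (p₂ ++ r₂)
++-⊆-∪ {p₁ = p₁} {p₂} {r₁ = r₁} {r₂} p⊆ r⊆ =
  subst (_ ⊆_) (sym (∪-++ p₁ p₂ r₁ r₂)) (⊆-++ p⊆ r⊆)

∣p─p∣≡0 : (p : Subset n) → ∣ p ─ p ∣ ≡ 0
∣p─p∣≡0 []            = refl
∣p─p∣≡0 (inside  ∷ p) = ∣p─p∣≡0 p
∣p─p∣≡0 (outside ∷ p) = ∣p─p∣≡0 p

⊥─p≡⊥ : (p : Subset n) → ⊥ ─ p ≡ ⊥
⊥─p≡⊥ []            = refl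
⊥─p≡⊥ (inside  ∷ p) = cong (outside ∷_) (⊥─p≡⊥ p)
⊥─p≡⊥ (outside ∷ p) = cong (outside ∷_) (⊥─p≡⊥ p)

⁅y⁆─⁅x⁆≡⁅y⁆ : {x y : Fin n} → x ≢ y → ⁅ y ⁆ ─ ⁅ x ⁆ ≡ ⁅ y ⁆
⁅y⁆─⁅x⁆≡⁅y⁆ {x = F.zero}  {F.zero}  x≢y = ⊥-elim (x≢y refl)
⁅y⁆─⁅x⁆≡⁅y⁆ {x = F.zero}  {F.suc y} _   = cong (outside ∷_) (p─⊥≡p ⁅ y ⁆)
⁅y⁆─⁅x⁆≡⁅y⁆ {x = F.suc x} {F.zero}  _   = cong (inside ∷_) (⊥─p≡⊥ ⁅ x ⁆)
⁅y⁆─⁅x⁆≡⁅y⁆ {x = F.suc x} {F.suc y} x≢y = cong (outside ∷_) (⁅y⁆─⁅x⁆≡⁅y⁆ (x≢y ∘ cong F.suc))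

∣⁅y⁆─⁅x⁆∣≡1 : {x y : Fin n} → x ≢ y → ∣ ⁅ y ⁆ ─ ⁅ x ⁆ ∣ ≡ 1
∣⁅y⁆─⁅x⁆∣≡1 {y = y} x≢y = trans (cong ∣_∣ (⁅y⁆─⁅x⁆≡⁅y⁆ x≢y)) (∣⁅x⁆∣≡1 y)

-- A chain without the requirement H_{i+1} ∩ H_i ≠ ∅; compounding with a
-- fixed nonempty edge restores that requirement.
record IsPreChain (ℋ : Family n) (q : ℕ) (C : Fin (suc q) → Subset n) : Set where
  field
    edges      : ∀ i → ℋ (C i)
    oneNew     : ∀ (i : Fin q) → ∣ C (F.suc i) ─ C (inject₁ i) ∣ ≡ 1
    insideEnds : ∀ (i : Fin q) → C (inject₁ i) ⊆ (C F.zero ∪ C (fromℕ q))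

PreConnected : Family n → Set
PreConnected {n} ℋ =
  ∀ H H' → ℋ H → ℋ H' →
  ∃₂ λ (q : ℕ) (C : Fin (suc q) → Subset n) →
    IsPreChain ℋ q C × C F.zero ≡ H × C (fromℕ q) ≡ H'

isPreChain : {ℋ : Family n} {C : Fin (suc q) → Subset n} → IsChain ℋ q C → IsPreChain ℋ q C
isPreChain c = record
  { edges = IsChain.edges c ; oneNew = IsChain.oneNew c ; insideEnds = IsChain.insideEnds c }

isPreChain-const : {ℋ : Family n} {H : Subset n} → ℋ H → IsPreChain ℋ 0 (λ _ → H)
isPreChain-const h = record { edges = λ _ → h ; oneNew = λ () ; insideEnds = λ () }

isPreChain-mono : {ℋ 𝒢 : Family n} {C : Fin (suc q) → Subset n} →
                  (∀ {E} → 𝒢 E → ℋ E) → IsPreChain 𝒢 q C → IsPreChain ℋ q C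
isPreChain-mono 𝒢⊆ℋ c = record
  { edges = 𝒢⊆ℋ ∘ IsPreChain.edges c
  ; oneNew = IsPreChain.oneNew c
  ; insideEnds = IsPreChain.insideEnds c
  }

propertyC⇒preConnected : {ℋ : Family n} → PropertyC ℋ → PreConnected ℋ
propertyC⇒preConnected c H H' h h' with ≡-dec _≟_ H H'
... | yes refl = 0 , _ , isPreChain-const h , refl , refl
... | no H≢H' with c H H' h h' H≢H'
...   | q , C , chain , C₀≡H , Cq≡H' = q , C , isPreChain chain , C₀≡H , Cq≡H'

preConnected-⇔ : {ℋ 𝒢 : Family n} → (∀ E → ℋ E ⇔ 𝒢 E) → PreConnected 𝒢 → PreConnected ℋ
preConnected-⇔ ℋ⇔𝒢 pre H H' h h'
  with pre H H' (Equivalence.to (ℋ⇔𝒢 H) h) (Equivalence.to (ℋ⇔𝒢 H') h')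
... | q , C , chain , C₀≡H , Cq≡H' =
  q , C , isPreChain-mono (Equivalence.from (ℋ⇔𝒢 _)) chain , C₀≡H , Cq≡H'

singletons-preConnected : PreConnected (Singletons n)
singletons-preConnected _ _ (a , refl) (b , refl) with a F.≟ b
... | yes refl = 0 , _ , isPreChain-const (a , refl) , refl , refl
... | no a≢b = 1 , (⁅ a ⁆ ◂ λ _ → ⁅ b ⁆) , record
  { edges = λ { F.zero → a , refl ; (F.suc F.zero) → b , refl }
  ; oneNew = λ { F.zero → ∣⁅y⁆─⁅x⁆∣≡1 a≢b }
  ; insideEnds = λ { F.zero → p⊆p∪q ⁅ b ⁆ }
  } , refl , refl

lift-isPreChain : {ℋ : Family n} {𝒢 : Family k} {C : Fin (suc q) → Subset n} {G : Subset k} →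
                  IsPreChain ℋ q C → 𝒢 G → Nonempty G → IsChain (ℋ ⊗ 𝒢) q (λ t → C t ++ G)
lift-isPreChain {C = C} {G} c g G≢∅ = record
  { edges = λ t → C t , G , IsPreChain.edges c t , g , refl
  ; meets = λ i → subst Nonempty (sym (∩-++ (C (F.suc i)) (C (inject₁ i)) G G))
                    (Nonempty-++ʳ _ (Nonempty-∩-self G≢∅))
  ; oneNew = λ i → begin
      ∣ (C (F.suc i) ++ G) ─ (C (inject₁ i) ++ G) ∣   ≡⟨ ∣─-++∣ (C (F.suc i)) (C (inject₁ i)) G G ⟩
      ∣ C (F.suc i) ─ C (inject₁ i) ∣ + ∣ G ─ G ∣     ≡⟨ cong₂ _+_ (IsPreChain.oneNew c i) (∣p─p∣≡0 G) ⟩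
      1 + 0                                           ∎
  ; insideEnds = λ i → ++-⊆-∪ (IsPreChain.insideEnds c i) (p⊆p∪q G)
  }
  where open ≡-Reasoning

∷-isChain : {ℋ : Family n} {C : Fin (suc q) → Subset n} {D : Subset n} →
            IsChain ℋ q C → ℋ D → Nonempty (C F.zero ∩ D) → ∣ C F.zero ─ D ∣ ≡ 1 →
            (∀ (i : Fin q) → C (inject₁ i) ⊆ D ∪ C (fromℕ q)) →
            IsChain ℋ (suc q) (D ◂ C)
∷-isChain c d C₀∩D≢∅ ∣C₀─D∣≡1 C⊆D∪Cq = record
  { edges = λ { F.zero → d ; (F.suc t) → IsChain.edges c t }
  ; meets = λ { F.zero → C₀∩D≢∅ ; (F.suc i) → IsChain.meets c i }
  ; oneNew = λ { F.zero → ∣C₀─D∣≡1 ; (F.suc i) → IsChain.oneNew c i }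
  ; insideEnds = λ { F.zero → p⊆p∪q _ ; (F.suc i) → C⊆D∪Cq i }
  }

⊗-singletons-propertyC : {ℋ : Family n} → (∀ E → ℋ E → Nonempty E) →
                         PreConnected ℋ → PropertyC (ℋ ⊗ Singletons k)
⊗-singletons-propertyC nonempty pre _ _
  (F , _ , h , (i , refl) , refl) (F' , _ , h' , (j , refl) , refl) _
  with pre F F' h h' | i F.≟ j
... | q , C , c , refl , refl | yes refl =
  q , _ , lift-isPreChain c (i , refl) (i , x∈⁅x⁆ i) , refl , refl
... | q , C , c , refl , refl | no i≢j =
  suc q , _ , ∷-isChain (lift-isPreChain c (j , refl) (j , x∈⁅x⁆ j)) (F , _ , h , (i , refl) , refl)
                meetsFirst oneNewFirst insideEnds , refl , refl
  where
  meetsFirst : Nonempty ((F ++ ⁅ j ⁆) ∩ (F ++ ⁅ i ⁆))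
  meetsFirst = subst Nonempty (sym (∩-++ F F ⁅ j ⁆ ⁅ i ⁆))
                 (Nonempty-++ˡ _ (Nonempty-∩-self (nonempty F h)))
  oneNewFirst : ∣ (F ++ ⁅ j ⁆) ─ (F ++ ⁅ i ⁆) ∣ ≡ 1
  oneNewFirst = trans (∣─-++∣ F F ⁅ j ⁆ ⁅ i ⁆) (cong₂ _+_ (∣p─p∣≡0 F) (∣⁅y⁆─⁅x⁆∣≡1 i≢j))
  insideEnds : ∀ t → C (inject₁ t) ++ ⁅ j ⁆ ⊆ (F ++ ⁅ i ⁆) ∪ (C (fromℕ q) ++ ⁅ j ⁆)
  insideEnds t = ++-⊆-∪ (IsPreChain.insideEnds c t) (q⊆p∪q ⁅ i ⁆ ⁅ j ⁆)

lemma10 : (k : ℕ) → 1 ≤ k → (n : ℕ) → (ℋ : Family n) → IsHypergraph ℋ →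
            (PropertyC ℋ ⊎ (1 ≤ n × (∀ (E : Subset n) → ℋ E ⇔ Singletons n E))) →
            PropertyC (ℋ ⊗ Singletons k)
lemma10 k _ n ℋ hyp alternatives =
  ⊗-singletons-propertyC (IsHypergraph.nonempty hyp) (preConnected alternatives)
  where
  preConnected : PropertyC ℋ ⊎ (1 ≤ n × (∀ E → ℋ E ⇔ Singletons n E)) → PreConnected ℋ
  preConnected (inj₁ c)         = propertyC⇒preConnected c
  preConnected (inj₂ (_ , ℋ⇔)) = preConnected-⇔ ℋ⇔ singletons-preConnected
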